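{- Let $G=(V,E)$ be a system and $t\geq 0$ an integer. Then any two distinct conditional faulty sets $F_1,F_2$ of $G$ with $|F_1|\leq t$ and $|F_2|\leq t$ form a distinguishable pair under the BGM model; that is, $G$ is conditionally $t$-diagnosable under the BGM model.
   Context: A system is a finite simple undirected graph $G=(V,E)$. For adjacent nodes $u,v$, the ordered pair $(u,v)$ is a test ($u$ tests $v$); every ordered pair of adjacent nodes is a test. A syndrome is a map $\sigma$ assigning to each test a result in $\{0,1\}$. A faulty set is any $F\subseteq V$. Under the BGM model, a syndrome $\sigma$ is consistent with $F$ if for every test $(u,v)$: if $u\notin F$ then $\sigma(u,v)=1$ exactly when $v\in F$; if $u,v\in F$ then $\sigma(u,v)=1$; if $u\in F$, $v\notin F$, $\sigma(u,v)$ may be $0$ or $1$. Let $\sigma(F)$ be the set of syndromes consistent with $F$; distinct $F_1,F_2$ form a distinguishable pair if $\sigma(F_1)\cap\sigma(F_2)=\emptyset$. A set $F\subseteq V$ is a conditional faulty set if $N_G(v)\not\subseteq F$ for every node $v\in V-F$, where $N_G(v)$ is the set of neighbors of $v$. $G$ is conditionally $t$-diagnosable if every two distinct conditional faulty sets of size at most $t$ form a distinguishable pair. -}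

module Defs where

open import Data.Nat using (ℕ; _≤_)
open import Data.Bool using (Bool; true; false)
open import Data.Fin using (Fin)
open import Data.Fin.Subset using (Subset; _∈_; _∉_; ∣_∣)
open import Data.Product using (_×_)
open import Data.Empty using (⊥)
open import Relation.Nullary using (¬_)
open import Relation.Binary.PropositionalEquality using (_≡_; _≢_)
open import Function.Bundles using (_⇔_)

record System : Set where
  field
    n      : ℕ
    adj    : Fin n → Fin n → Bool
    sym    : ∀ u v → adj u v ≡ adj v u
    irrefl : ∀ v → adj v v ≡ false

module _ (G : System) where
  open System G

  Node : Set
  Node = Fin n

  -- u and v are adjacent; (u , v) is then a test (u tests v).
  Adj : Node → Node → Set
  Adj u v = adj u v ≡ true

  -- A syndrome assigns a result in {0,1} (false = 0, true = 1) to each test.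
  Syndrome : Set
  Syndrome = (u v : Node) → Adj u v → Bool

  FaultySet : Set
  FaultySet = Subset n

  Consistent : Syndrome → FaultySet → Set
  Consistent σ F = ∀ u v (e : Adj u v) →
    (u ∉ F → ((σ u v e ≡ true) ⇔ (v ∈ F))) ×
    (u ∈ F → v ∈ F → σ u v e ≡ true)

  Distinguishable : FaultySet → FaultySet → Set
  Distinguishable F₁ F₂ = ∀ (σ : Syndrome) → Consistent σ F₁ → Consistent σ F₂ → ⊥

  NbhdSubset : Node → FaultySet → Set
  NbhdSubset v F = ∀ w → Adj v w → w ∈ F

  ConditionalFaultySet : FaultySet → Set
  ConditionalFaultySet F = ∀ v → v ∉ F → ¬ NbhdSubset v F

  ConditionallyDiagnosable : ℕ → Set
  ConditionallyDiagnosable t = ∀ (F₁ F₂ : FaultySet) → F₁ ≢ F₂ →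
    ConditionalFaultySet F₁ → ConditionalFaultySet F₂ →
    ∣ F₁ ∣ ≤ t → ∣ F₂ ∣ ≤ t → Distinguishable F₁ F₂

{-# OPTIONS --safe #-}
-- If a syndrome σ is consistent with both F₁ and F₂, take v ∈ F₁ − F₂. Any neighbour w of v
-- reports v as faulty in σ: a fault-free w because v ∈ F₁, a faulty w because under BGM faulty
-- testers report faulty nodes as faulty. Were w ∉ F₂, this report would put v in F₂; hence
-- N(v) ⊆ F₂, which a conditional faulty set F₂ forbids. So F₁ ⊆ F₂, symmetrically F₂ ⊆ F₁.
module Submission where

open import Defs
open import Data.Nat using (ℕ)
open import Data.Bool using (true)
open import Data.Fin.Subset using (_∈_; _∉_; _⊆_)
open import Data.Fin.Subset.Properties using (_∈?_; ⊆-antisym)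
open import Data.Product using (proj₁; proj₂)
open import Data.Empty using (⊥-elim)
open import Relation.Nullary using (yes; no)
open import Relation.Binary.PropositionalEquality using (_≡_; trans)
open import Function.Bundles using (Equivalence)

module _ {G : System} where
  open System G using (sym)

  Adj-sym : ∀ {u v} → Adj G u v → Adj G v u
  Adj-sym {u} {v} e = trans (sym v u) e

  consistent-faulty⇒true : ∀ {σ F} → Consistent G σ F →
                           ∀ {u v} (e : Adj G u v) → v ∈ F → σ u v e ≡ true
  consistent-faulty⇒true {F = F} C {u} {v} e v∈F with u ∈? F
  ... | yes u∈F = proj₂ (C u v e) u∈F v∈F
  ... | no  u∉F = Equivalence.from (proj₁ (C u v e) u∉F) v∈F

  consistent-true⇒faulty : ∀ {σ F} → Consistent G σ F →
                           ∀ {u v} (e : Adj G u v) → u ∉ F → σ u v e ≡ true → v ∈ F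
  consistent-true⇒faulty C {u} {v} e u∉F = Equivalence.to (proj₁ (C u v e) u∉F)

  consistent-∈-∉⇒NbhdSubset : ∀ {σ F₁ F₂} → Consistent G σ F₁ → Consistent G σ F₂ →
                              ∀ {v} → v ∈ F₁ → v ∉ F₂ → NbhdSubset G v F₂
  consistent-∈-∉⇒NbhdSubset {F₂ = F₂} C₁ C₂ v∈F₁ v∉F₂ w vw with w ∈? F₂
  ... | yes w∈F₂ = w∈F₂
  ... | no  w∉F₂ = ⊥-elim (v∉F₂ (consistent-true⇒faulty C₂ wv w∉F₂
                                   (consistent-faulty⇒true C₁ wv v∈F₁)))
    where wv = Adj-sym vw

  consistent-conditional⇒⊆ : ∀ {σ F₁ F₂} → Consistent G σ F₁ → Consistent G σ F₂ →
                             ConditionalFaultySet G F₂ → F₁ ⊆ F₂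
  consistent-conditional⇒⊆ {F₂ = F₂} C₁ C₂ cond {v} v∈F₁ with v ∈? F₂
  ... | yes v∈F₂ = v∈F₂
  ... | no  v∉F₂ = ⊥-elim (cond v v∉F₂ (consistent-∈-∉⇒NbhdSubset C₁ C₂ v∈F₁ v∉F₂))

theorem5p1 : (G : System) (t : ℕ) → ConditionallyDiagnosable G t
theorem5p1 G t F₁ F₂ F₁≢F₂ cond₁ cond₂ _ _ σ C₁ C₂ =
  F₁≢F₂ (⊆-antisym (consistent-conditional⇒⊆ {G} C₁ C₂ cond₂)
                   (consistent-conditional⇒⊆ {G} C₂ C₁ cond₁))
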